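{- There exists a uniformly introenumerable set $G$ such that for every infinite set $A$ with $A\le_e G$, it is not the case that $G\le^{ui}_T A$.
   Context: An enumeration operator $\Theta$ is a c.e. set of pairs $\langle u,n\rangle$, with $\Theta(X)=\{n:\exists u\,(D_u\subseteq X\wedge\langle u,n\rangle\in\Theta)\}$; $A\le_e X$ if $A=\Theta(X)$ for some enumeration operator. An infinite set $G$ is uniformly introenumerable if a single enumeration operator $\Theta$ has $\Theta(C)=G$ for every infinite $C\subseteq G$. For infinite $G,A$, $G\le^{ui}_T A$ means there is a single Turing functional $\Phi$ with $\Phi^C=G$ for every infinite $C\subseteq A$. -}

module Defs where

open import Level using (0ℓ)
open import Data.Nat using (ℕ; zero; suc; _≤_; _<_)
open import Data.Nat.DivMod using (_/_; _%_)
open import Data.Fin using (Fin)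
open import Data.Vec using (Vec; []; _∷_; lookup)
open import Data.Product using (Σ; ∃; _×_; _,_)
open import Data.Empty using (⊥)
open import Relation.Nullary using (¬_)
open import Relation.Binary.PropositionalEquality using (_≡_)

Pred : Set₁
Pred = ℕ → Set

_⊆_ : Pred → Pred → Set
A ⊆ B = ∀ n → A n → B n

infix 4 _≐_
_≐_ : Pred → Pred → Set
A ≐ B = ∀ n → (A n → B n) × (B n → A n)

Infinite : Pred → Set
Infinite A = ∀ n → ∃ λ m → n ≤ m × A m

-- Oracles as functional relations ℕ → ℕ → Set (x ↦ answer).

Oracle : Set₁
Oracle = ℕ → ℕ → Set

χ : Pred → Oracle
χ C x zero = ¬ C x
χ C x (suc zero) = C x
χ C x (suc (suc _)) = ⊥

-- the empty oracle (used for ordinary, unrelativised computations)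
emptyOracle : Oracle
emptyOracle x b = b ≡ 0

-- Partial recursive functions relative to an oracle (μ-recursive
-- terms with an oracle-query basic function), with a big-step
-- evaluation relation.

data Rec : ℕ → Set where
  zer    : ∀ {n} → Rec n
  succ   : Rec 1
  proj   : ∀ {n} → Fin n → Rec n
  comp   : ∀ {m n} → Rec m → Vec (Rec n) m → Rec n
  prec   : ∀ {n} → Rec n → Rec (suc (suc n)) → Rec (suc n)
  mu     : ∀ {n} → Rec (suc n) → Rec n
  query  : Rec 1

mutual
  data Eval (O : Oracle) : ∀ {n} → Rec n → Vec ℕ n → ℕ → Set where
    ev-zer   : ∀ {n} {xs : Vec ℕ n} → Eval O zer xs 0
    ev-succ  : ∀ {x} → Eval O succ (x ∷ []) (suc x)
    ev-proj  : ∀ {n} {i : Fin n} {xs} → Eval O (proj i) xs (lookup xs i)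
    ev-comp  : ∀ {m n} {f : Rec m} {gs : Vec (Rec n) m} {xs ys y} →
               EvalVec O xs gs ys → Eval O f ys y → Eval O (comp f gs) xs y
    ev-prec0 : ∀ {n} {g : Rec n} {h} {xs y} →
               Eval O g xs y → Eval O (prec g h) (zero ∷ xs) y
    ev-precS : ∀ {n} {g : Rec n} {h} {k xs r y} →
               Eval O (prec g h) (k ∷ xs) r →
               Eval O h (k ∷ r ∷ xs) y → Eval O (prec g h) (suc k ∷ xs) y
    ev-mu    : ∀ {n} {f : Rec (suc n)} {xs y} →
               Eval O f (y ∷ xs) 0 →
               (∀ z → z < y → ∃ λ k → Eval O f (z ∷ xs) (suc k)) →
               Eval O (mu f) xs y
    ev-query : ∀ {x b} → O x b → Eval O query (x ∷ []) b

  data EvalVec (O : Oracle) {n} (xs : Vec ℕ n) : ∀ {m} → Vec (Rec n) m → Vec ℕ m → Set where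
    []  : EvalVec O xs [] []
    _∷_ : ∀ {m g y} {gs : Vec (Rec n) m} {ys} →
          Eval O g xs y → EvalVec O xs gs ys → EvalVec O xs (g ∷ gs) (y ∷ ys)

-- Canonical finite sets: i ∈ D_u iff the i-th binary digit of u is 1.

bit : ℕ → ℕ → ℕ
bit u zero = u % 2
bit u (suc i) = bit (u / 2) i

D : ℕ → Pred
D u i = bit u i ≡ 1

-- Enumeration operators: c.e. sets of pairs ⟨u,n⟩, given as domains
-- of binary partial recursive functions (unrelativised).

EnumOp : Set
EnumOp = Rec 2

_∋⟨_,_⟩ : EnumOp → ℕ → ℕ → Set
Θ ∋⟨ u , n ⟩ = ∃ λ y → Eval emptyOracle Θ (u ∷ n ∷ []) y

infix 10 _⟨_⟩
_⟨_⟩ : EnumOp → Pred → Pred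
Θ ⟨ X ⟩ = λ n → ∃ λ u → (D u ⊆ X) × (Θ ∋⟨ u , n ⟩)

_≤e_ : Pred → Pred → Set
A ≤e X = ∃ λ (Θ : EnumOp) → Θ ⟨ X ⟩ ≐ A

UniformlyIntroenumerable : Pred → Set₁
UniformlyIntroenumerable G =
  Infinite G × ∃ λ (Θ : EnumOp) → ∀ C → Infinite C → C ⊆ G → Θ ⟨ C ⟩ ≐ G

-- Turing functionals: unary partial recursive functions with oracle.
-- Φ^C = G : Φ with oracle χ_C computes the characteristic function of G.

TuringFunctional : Set
TuringFunctional = Rec 1

_^_≡χ_ : TuringFunctional → Pred → Pred → Set
Φ ^ C ≡χ G = ∀ n → (G n → Eval (χ C) Φ (n ∷ []) 1)
                   × (¬ G n → Eval (χ C) Φ (n ∷ []) 0)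

_≤uiT_ : Pred → Pred → Set₁
G ≤uiT A = ∃ λ (Φ : TuringFunctional) → ∀ C → Infinite C → C ⊆ A → Φ ^ C ≡χ G

{-# OPTIONS --safe #-}
module Submission where

-- G is built in finite stages G[ t ]. Every element of G codes an earlier stage G[ r ]: its odd
-- binary digits list G[ r ] and its even digits carry a tag. Stage r adds the code marker r, so G
-- is infinite and its large elements code late stages; hence Θᴳ, which enumerates every n listed
-- by some element of D u, recovers all of G from any infinite subset of G.
-- The code witness r is reserved for the r-th pair (Θ , Φ): it enters G at stage t once Φ, run
-- for t steps against the stage-t approximation of Θ (G), answers that witness r is not in G.
-- If A = Θ (G) is infinite and Φ computes G from every infinite subset of A, witness r cannot
-- enter, since the finite oracle Φ consulted extends to an infinite subset of A on which Φ would
-- then be wrong. So Φ with oracle A answers 0 on witness r; this computation makes finitely many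
-- queries, which the approximations eventually answer correctly, so witness r enters after all.

open import Defs
open import Data.Bool using (Bool; true; false; T; not; _∧_; _∨_; if_then_else_)
open import Data.Bool.Properties using (T-∧; T-∨)
open import Data.Empty using (⊥-elim)
open import Data.Fin using (#_)
import Data.List as List
open import Data.List using (List; _++_; upTo; allFin; cartesianProductWith; cartesianProduct; concatMap; head; drop)
open import Data.List.Membership.Propositional using (_∈_; lose)
open import Data.List.Membership.Propositional.Properties
  using ( ∈-++⁺ˡ; ∈-++⁺ʳ; ∈-map⁺; ∈-allFin; ∈-upTo⁺; ∈-concatMap⁺
        ; ∈-cartesianProductWith⁺; ∈-cartesianProduct⁺)
open import Data.List.Relation.Unary.Any using (here; there)
import Data.Maybe as Maybe
open import Data.Maybe using (Maybe; just; nothing; is-just; fromMaybe; _>>=_)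
open import Data.Maybe.Properties using (just-injective)
open import Data.Nat
  using (ℕ; zero; suc; _+_; _*_; _≤_; _<_; z≤n; s≤s; _≤′_; ≤′-refl; ≤′-step; _⊔_; _≡ᵇ_; _≤ᵇ_; _≟_)
open import Data.Nat.Properties
open import Data.Nat.DivMod using (_/_; _%_; m%n<n; m/n≡1+[m∸n]/n; m/n*n≤m)
open import Data.Product using (Σ; ∃; _×_; _,_; proj₁; proj₂; swap)
open import Data.Sum using (_⊎_; inj₁; inj₂; [_,_]′)
open import Data.Vec using (Vec; []; _∷_; lookup)
open import Function using (_∘_; id; _⇔_; mk⇔; Equivalence)
import Function.Properties.Equivalence as ⇔
open import Relation.Nullary using (¬_; yes; no)
open import Relation.Unary using (Decidable)
open import Relation.Binary using (tri<; tri≈; tri>)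
open import Relation.Binary.PropositionalEquality

open Equivalence using (to; from)

double : ℕ → ℕ
double zero    = zero
double (suc n) = suc (suc (double n))

pushBit : Bool → ℕ → ℕ
pushBit false m = double m
pushBit true  m = suc (double m)

[2+n]/2≡1+n/2 : ∀ n → suc (suc n) / 2 ≡ suc (n / 2)
[2+n]/2≡1+n/2 n = m/n≡1+[m∸n]/n {suc (suc n)} {2} (s≤s (s≤s z≤n))

pushBit/2 : ∀ b m → pushBit b m / 2 ≡ m
pushBit/2 false zero    = refl
pushBit/2 true  zero    = refl
pushBit/2 false (suc m) = trans ([2+n]/2≡1+n/2 (double m)) (cong suc (pushBit/2 false m))
pushBit/2 true  (suc m) = trans ([2+n]/2≡1+n/2 (suc (double m))) (cong suc (pushBit/2 true m))

D-pushBit-zero : ∀ b m → D (pushBit b m) 0 ⇔ T b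
D-pushBit-zero false m = mk⇔ (λ d → 0≢1+n (trans (sym (double%2 m)) d)) λ ()
  where
  double%2 : ∀ m → double m % 2 ≡ 0
  double%2 zero    = refl
  double%2 (suc m) = double%2 m
D-pushBit-zero true m = mk⇔ _ (λ _ → 1+double%2 m)
  where
  1+double%2 : ∀ m → suc (double m) % 2 ≡ 1
  1+double%2 zero    = refl
  1+double%2 (suc m) = 1+double%2 m

D-pushBit-suc : ∀ b m i → D (pushBit b m) (suc i) ⇔ D m i
D-pushBit-suc b m i = mk⇔ (trans (sym eq)) (trans eq)
  where
  eq : bit (pushBit b m) (suc i) ≡ bit m i
  eq = cong (λ k → bit k i) (pushBit/2 b m)

¬D-0 : ∀ i → ¬ D 0 i
¬D-0 zero    ()
¬D-0 (suc i) = ¬D-0 i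

bit≤1 : ∀ u i → bit u i ≤ 1
bit≤1 u zero    = m<1+n⇒m≤n (m%n<n u 2)
bit≤1 u (suc i) = bit≤1 (u / 2) i

D⇒< : ∀ {u} i → D u i → i < u
D⇒< {zero}  i       d = ⊥-elim (¬D-0 i d)
D⇒< {suc u} zero    d = s≤s z≤n
D⇒< {u}     (suc i) d = begin
    suc (suc i)      ≤⟨ s≤s (m≤n+m (suc i) i) ⟩
    suc i + suc i    ≤⟨ +-mono-≤ i<u/2 i<u/2 ⟩
    u / 2 + u / 2    ≡⟨ cong (u / 2 +_) (sym (+-identityʳ (u / 2))) ⟩
    2 * (u / 2)      ≡⟨ *-comm 2 (u / 2) ⟩
    u / 2 * 2        ≤⟨ m/n*n≤m u 2 ⟩
    u                ∎
  where
  open ≤-Reasoning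
  i<u/2 : i < u / 2
  i<u/2 = D⇒< i d

fromBits : ℕ → (ℕ → Bool) → ℕ
fromBits zero    f = 0
fromBits (suc l) f = pushBit (f 0) (fromBits l (f ∘ suc))

D-fromBits : ∀ l f → (∀ j → l ≤ j → ¬ T (f j)) → ∀ j → D (fromBits l f) j ⇔ T (f j)
D-fromBits zero    f f≥l j       = mk⇔ (⊥-elim ∘ ¬D-0 j) (⊥-elim ∘ f≥l j z≤n)
D-fromBits (suc l) f f≥l zero    = D-pushBit-zero (f 0) _
D-fromBits (suc l) f f≥l (suc j) = ⇔.trans (D-pushBit-suc (f 0) _ j)
  (D-fromBits l (f ∘ suc) (λ j l≤j → f≥l (suc j) (s≤s l≤j)) j)

singleton : ℕ → ℕ
singleton x = fromBits (suc x) (_≡ᵇ x)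

D-singleton : ∀ x j → D (singleton x) j ⇔ j ≡ x
D-singleton x j = ⇔.trans (D-fromBits (suc x) (_≡ᵇ x) x<j⇒≢ j) (mk⇔ (≡ᵇ⇒≡ j x) (≡⇒≡ᵇ j x))
  where
  x<j⇒≢ : ∀ j → suc x ≤ j → ¬ T (j ≡ᵇ x)
  x<j⇒≢ j x<j e = <⇒≢ x<j (sym (≡ᵇ⇒≡ j x e))

anyBelow : ℕ → (ℕ → Bool) → Bool
anyBelow zero    f = false
anyBelow (suc n) f = f n ∨ anyBelow n f

allBelow : ℕ → (ℕ → Bool) → Bool
allBelow zero    f = true
allBelow (suc n) f = f n ∧ allBelow n f

maxBelow : ℕ → (ℕ → ℕ) → ℕ
maxBelow zero    f = 0
maxBelow (suc n) f = f n ⊔ maxBelow n f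

anyBelow⁺ : ∀ n f {r} → r < n → T (f r) → T (anyBelow n f)
anyBelow⁺ (suc n) f r<1+n fr with m≤n⇒m<n∨m≡n (≤-pred r<1+n)
... | inj₁ r<n  = from T-∨ (inj₂ (anyBelow⁺ n f r<n fr))
... | inj₂ refl = from T-∨ (inj₁ fr)

anyBelow⁻ : ∀ n f → T (anyBelow n f) → ∃ λ r → r < n × T (f r)
anyBelow⁻ (suc n) f any with to T-∨ any
... | inj₁ fn   = n , n<1+n n , fn
... | inj₂ any′ with anyBelow⁻ n f any′
...   | r , r<n , fr = r , m<n⇒m<1+n r<n , fr

allBelow⁺ : ∀ n f → (∀ r → r < n → T (f r)) → T (allBelow n f)
allBelow⁺ zero    f all = _
allBelow⁺ (suc n) f all = from T-∧ (all n (n<1+n n) , allBelow⁺ n f (λ r r<n → all r (m<n⇒m<1+n r<n)))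

allBelow⁻ : ∀ n f → T (allBelow n f) → ∀ r → r < n → T (f r)
allBelow⁻ (suc n) f all r r<1+n with to T-∧ all | m≤n⇒m<n∨m≡n (≤-pred r<1+n)
... | _  , all′ | inj₁ r<n  = allBelow⁻ n f all′ r r<n
... | fn , _    | inj₂ refl = fn

maxBelow-upper : ∀ n f {r} → r < n → f r ≤ maxBelow n f
maxBelow-upper (suc n) f r<1+n with m≤n⇒m<n∨m≡n (≤-pred r<1+n)
... | inj₁ r<n  = m≤n⇒m≤o⊔n (f n) (maxBelow-upper n f r<n)
... | inj₂ refl = m≤m⊔n (f n) _

common-bound : (P : ℕ → ℕ → Set) → (∀ {i s s′} → s ≤ s′ → P i s → P i s′) →
               ∀ n → (∀ i → i < n → ∃ (P i)) → ∃ λ s → ∀ i → i < n → P i s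
common-bound P up zero    ex = 0 , λ _ ()
common-bound P up (suc n) ex with common-bound P up n (λ i i<n → ex i (m<n⇒m<1+n i<n)) | ex n (n<1+n n)
... | s , below | s′ , at = s ⊔ s′ , λ i i<1+n → case i (m≤n⇒m<n∨m≡n (≤-pred i<1+n))
  where
  case : ∀ i → i < n ⊎ i ≡ n → P i (s ⊔ s′)
  case i (inj₁ i<n)  = up (m≤m⊔n s s′) (below i i<n)
  case i (inj₂ refl) = up (m≤n⊔m s s′) at

_⊆ᴼ_ : Oracle → Oracle → Set
O ⊆ᴼ O′ = ∀ x b → O x b → O′ x b

Functional : Oracle → Set
Functional O = ∀ x {b b′} → O x b → O x b′ → b ≡ b′

χ-functional : ∀ C → Functional (χ C)
χ-functional C x {zero}        {zero}        _   _   = refl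
χ-functional C x {zero}        {suc zero}    ¬Cx Cx  = ⊥-elim (¬Cx Cx)
χ-functional C x {suc zero}    {zero}        Cx  ¬Cx = ⊥-elim (¬Cx Cx)
χ-functional C x {suc zero}    {suc zero}    _   _   = refl
χ-functional C x {suc (suc _)} ()
χ-functional C x {zero}        {suc (suc _)} _   ()
χ-functional C x {suc zero}    {suc (suc _)} _   ()

χ-cong : ∀ {X Y} → X ≐ Y → χ X ⊆ᴼ χ Y
χ-cong X≐Y x zero          ¬Xx = ¬Xx ∘ proj₂ (X≐Y x)
χ-cong X≐Y x (suc zero)    Xx  = proj₁ (X≐Y x) Xx
χ-cong X≐Y x (suc (suc _)) ()

emptyOracle-functional : Functional emptyOracle
emptyOracle-functional _ refl refl = refl

mutual
  Eval-mono : ∀ {O O′} → O ⊆ᴼ O′ → ∀ {n} {p : Rec n} {xs y} → Eval O p xs y → Eval O′ p xs y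
  Eval-mono O⊆O′ ev-zer          = ev-zer
  Eval-mono O⊆O′ ev-succ         = ev-succ
  Eval-mono O⊆O′ ev-proj         = ev-proj
  Eval-mono O⊆O′ (ev-comp ds d)  = ev-comp (EvalVec-mono O⊆O′ ds) (Eval-mono O⊆O′ d)
  Eval-mono O⊆O′ (ev-prec0 d)    = ev-prec0 (Eval-mono O⊆O′ d)
  Eval-mono O⊆O′ (ev-precS d e)  = ev-precS (Eval-mono O⊆O′ d) (Eval-mono O⊆O′ e)
  Eval-mono O⊆O′ (ev-mu d below) =
    ev-mu (Eval-mono O⊆O′ d) (λ z z<y → proj₁ (below z z<y) , Eval-mono O⊆O′ (proj₂ (below z z<y)))
  Eval-mono O⊆O′ (ev-query o)    = ev-query (O⊆O′ _ _ o)

  EvalVec-mono : ∀ {O O′} → O ⊆ᴼ O′ →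
                 ∀ {n m} {xs : Vec ℕ n} {gs : Vec (Rec n) m} {ys} → EvalVec O xs gs ys → EvalVec O′ xs gs ys
  EvalVec-mono O⊆O′ []       = []
  EvalVec-mono O⊆O′ (d ∷ ds) = Eval-mono O⊆O′ d ∷ EvalVec-mono O⊆O′ ds

mutual
  Eval-functional : ∀ {O} → Functional O →
                    ∀ {n} {p : Rec n} {xs y y′} → Eval O p xs y → Eval O p xs y′ → y ≡ y′
  Eval-functional F ev-zer         ev-zer           = refl
  Eval-functional F ev-succ        ev-succ          = refl
  Eval-functional F ev-proj        ev-proj          = refl
  Eval-functional F (ev-comp ds d) (ev-comp ds′ d′) with EvalVec-functional F ds ds′
  ... | refl = Eval-functional F d d′
  Eval-functional F (ev-prec0 d)   (ev-prec0 d′)    = Eval-functional F d d′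
  Eval-functional F (ev-precS d e) (ev-precS d′ e′) with Eval-functional F d d′
  ... | refl = Eval-functional F e e′
  Eval-functional F (ev-mu {y = y} d below) (ev-mu {y = y′} d′ below′) with <-cmp y y′
  ... | tri< y<y′ _ _ = ⊥-elim (0≢1+n (Eval-functional F d (proj₂ (below′ y y<y′))))
  ... | tri≈ _ y≡y′ _ = y≡y′
  ... | tri> _ _ y′<y = ⊥-elim (0≢1+n (Eval-functional F d′ (proj₂ (below y′ y′<y))))
  Eval-functional F (ev-query o)   (ev-query o′)    = F _ o o′

  EvalVec-functional : ∀ {O} → Functional O → ∀ {n m} {xs : Vec ℕ n} {gs : Vec (Rec n) m} {ys ys′} →
                       EvalVec O xs gs ys → EvalVec O xs gs ys′ → ys ≡ ys′
  EvalVec-functional F []       []         = refl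
  EvalVec-functional F (d ∷ ds) (d′ ∷ ds′) = cong₂ _∷_ (Eval-functional F d d′) (EvalVec-functional F ds ds′)

-- Fuel-bounded evaluation

PartialOracle : Set
PartialOracle = ℕ → Maybe ℕ

graph : PartialOracle → Oracle
graph o x b = o x ≡ just b

mutual
  eval : ℕ → PartialOracle → ∀ {n} → Rec n → Vec ℕ n → Maybe ℕ
  eval zero    o p           xs           = nothing
  eval (suc f) o zer         xs           = just 0
  eval (suc f) o succ        (x ∷ [])     = just (suc x)
  eval (suc f) o (proj i)    xs           = just (lookup xs i)
  eval (suc f) o (comp g gs) xs           = evalVec f o gs xs >>= eval f o g
  eval (suc f) o (prec g h)  (zero ∷ xs)  = eval f o g xs
  eval (suc f) o (prec g h)  (suc k ∷ xs) = eval f o (prec g h) (k ∷ xs) >>= λ r → eval f o h (k ∷ r ∷ xs)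
  eval (suc f) o (mu g)      xs           = search f o g xs 0 f
  eval (suc f) o query       (x ∷ [])     = o x

  evalVec : ℕ → PartialOracle → ∀ {n m} → Vec (Rec n) m → Vec ℕ n → Maybe (Vec ℕ m)
  evalVec f o []       xs = just []
  evalVec f o (g ∷ gs) xs = eval f o g xs >>= λ y → Maybe.map (y ∷_) (evalVec f o gs xs)

  -- the least zero of g (_ ∷ xs) among z, z + 1, …, z + st - 1
  search : ℕ → PartialOracle → ∀ {n} → Rec (suc n) → Vec ℕ n → ℕ → ℕ → Maybe ℕ
  search f o g xs z zero     = nothing
  search f o g xs z (suc st) with eval f o g (z ∷ xs)
  ... | nothing      = nothing
  ... | just zero    = just z
  ... | just (suc _) = search f o g xs (suc z) st

>>=-just⁻ : ∀ {A B : Set} (m : Maybe A) {k : A → Maybe B} {b} →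
            (m >>= k) ≡ just b → ∃ λ a → m ≡ just a × k a ≡ just b
>>=-just⁻ (just a) e = a , refl , e

>>=-just⁺ : ∀ {A B : Set} {m : Maybe A} {k : A → Maybe B} {a b} →
            m ≡ just a → k a ≡ just b → (m >>= k) ≡ just b
>>=-just⁺ refl e = e

map-∷-just⁻ : ∀ {m y} (r : Maybe (Vec ℕ m)) {zs} →
              Maybe.map (y ∷_) r ≡ just zs → ∃ λ ys → r ≡ just ys × zs ≡ y ∷ ys
map-∷-just⁻ (just ys) refl = ys , refl , refl

LeastZeroFrom : Oracle → ∀ {n} → Rec (suc n) → Vec ℕ n → ℕ → ℕ → Set
LeastZeroFrom O g xs z y =
  z ≤ y × Eval O g (y ∷ xs) 0 × (∀ w → z ≤ w → w < y → ∃ λ k → Eval O g (w ∷ xs) (suc k))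

mutual
  eval-sound : ∀ f o {n} (p : Rec n) xs {y} → eval f o p xs ≡ just y → Eval (graph o) p xs y
  eval-sound (suc f) o zer         xs           refl = ev-zer
  eval-sound (suc f) o succ        (x ∷ [])     refl = ev-succ
  eval-sound (suc f) o (proj i)    xs           refl = ev-proj
  eval-sound (suc f) o (comp g gs) xs           e    with >>=-just⁻ (evalVec f o gs xs) e
  ... | ys , e₁ , e₂ = ev-comp (evalVec-sound f o gs xs e₁) (eval-sound f o g ys e₂)
  eval-sound (suc f) o (prec g h)  (zero ∷ xs)  e    = ev-prec0 (eval-sound f o g xs e)
  eval-sound (suc f) o (prec g h)  (suc k ∷ xs) e    with >>=-just⁻ (eval f o (prec g h) (k ∷ xs)) e
  ... | r , e₁ , e₂ = ev-precS (eval-sound f o (prec g h) (k ∷ xs) e₁) (eval-sound f o h (k ∷ r ∷ xs) e₂)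
  eval-sound (suc f) o (mu g)      xs           e    with search-sound f o g xs 0 f e
  ... | _ , d , below = ev-mu d (λ w w<y → below w z≤n w<y)
  eval-sound (suc f) o query       (x ∷ [])     e    = ev-query e

  evalVec-sound : ∀ f o {n m} (gs : Vec (Rec n) m) xs {ys} → evalVec f o gs xs ≡ just ys → EvalVec (graph o) xs gs ys
  evalVec-sound f o []       xs refl = []
  evalVec-sound f o (g ∷ gs) xs e    with >>=-just⁻ (eval f o g xs) e
  ... | y , e₁ , e₂ with map-∷-just⁻ (evalVec f o gs xs) e₂
  ... | ys , e₃ , refl = eval-sound f o g xs e₁ ∷ evalVec-sound f o gs xs e₃

  search-sound : ∀ f o {n} (g : Rec (suc n)) xs z st {y} → search f o g xs z st ≡ just y →
                 LeastZeroFrom (graph o) g xs z y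
  search-sound f o g xs z (suc st) e with eval f o g (z ∷ xs) in e₀
  search-sound f o g xs z (suc st) refl | just zero =
    ≤-refl , eval-sound f o g (z ∷ xs) e₀ , λ w z≤w w<z → ⊥-elim (≤⇒≯ z≤w w<z)
  search-sound f o g xs z (suc st) e    | just (suc k) with search-sound f o g xs (suc z) st e
  ... | z<y , d , below = <⇒≤ z<y , d , λ w z≤w w<y →
    [ (λ z<w → below w z<w w<y) , (λ { refl → k , eval-sound f o g (z ∷ xs) e₀ }) ]′ (m≤n⇒m<n∨m≡n z≤w)

search-complete : ∀ f o {n} (g : Rec (suc n)) xs {y} → eval f o g (y ∷ xs) ≡ just 0 →
                  (∀ w → w < y → ∃ λ k → eval f o g (w ∷ xs) ≡ just (suc k)) →
                  ∀ z st → z ≤ y → y < z + st → search f o g xs z st ≡ just y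
search-complete f o g xs {y} zero-at below z zero     z≤y y<z+0  =
  ⊥-elim (≤⇒≯ z≤y (subst (y <_) (+-identityʳ z) y<z+0))
search-complete f o g xs {y} zero-at below z (suc st) z≤y y<z+st with m≤n⇒m<n∨m≡n z≤y
... | inj₂ refl rewrite zero-at = refl
... | inj₁ z<y  with below z z<y
...   | k , e rewrite e =
  search-complete f o g xs zero-at below (suc z) st z<y (subst (y <_) (+-suc z st) y<z+st)

-- Evaluation relative to converging approximations

ConvergesTo : (ℕ → PartialOracle) → Oracle → Set
ConvergesTo os O = ∀ x b → O x b → ∃ λ t₀ → ∀ t → t₀ ≤ t → os t x ≡ just b

-- f is the fuel given to eval, t the index of the approximating oracle
Eventually : (ℕ → ℕ → Set) → Set
Eventually P = ∃ λ N → ∀ f t → N ≤ f → N ≤ t → P f t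

eventually-map : ∀ {P Q : ℕ → ℕ → Set} → (∀ {f t} → P f t → Q f t) → Eventually P → Eventually Q
eventually-map P⇒Q (N , p) = N , λ f t N≤f N≤t → P⇒Q (p f t N≤f N≤t)

eventually-suc : ∀ {P Q : ℕ → ℕ → Set} → (∀ {f t} → P f t → Q (suc f) t) → Eventually P → Eventually Q
eventually-suc P⇒Q (N , p) = suc N , λ { zero t () _ ; (suc f) t N<1+f N<t → P⇒Q (p f t (≤-pred N<1+f) (<⇒≤ N<t)) }

eventually-× : ∀ {P Q : ℕ → ℕ → Set} → Eventually P → Eventually Q → Eventually (λ f t → P f t × Q f t)
eventually-× (N , p) (N′ , q) = N ⊔ N′ , λ f t N⊔N′≤f N⊔N′≤t →
  p f t (m⊔n≤o⇒m≤o N N′ N⊔N′≤f) (m⊔n≤o⇒m≤o N N′ N⊔N′≤t) ,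
  q f t (m⊔n≤o⇒n≤o N N′ N⊔N′≤f) (m⊔n≤o⇒n≤o N N′ N⊔N′≤t)

eventually-∀< : ∀ {P : ℕ → ℕ → ℕ → Set} n → (∀ i → i < n → Eventually (P i)) →
                Eventually (λ f t → ∀ i → i < n → P i f t)
eventually-∀< {P} n ev
  with common-bound (λ i N → ∀ f t → N ≤ f → N ≤ t → P i f t)
         (λ N≤N′ p f t N′≤f N′≤t → p f t (≤-trans N≤N′ N′≤f) (≤-trans N≤N′ N′≤t)) n ev
... | N , p = N , λ f t N≤f N≤t i i<n → p i i<n f t N≤f N≤t

fuel-eventually-> : ∀ n → Eventually (λ f t → n < f)
fuel-eventually-> n = suc n , λ f t n<f _ → n<f

module _ {os : ℕ → PartialOracle} {O : Oracle} (os→O : ConvergesTo os O) where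

  immediately : ∀ {n} {p : Rec n} {xs y} → (∀ {f t} → eval (suc f) (os t) p xs ≡ just y) →
                Eventually (λ f t → eval f (os t) p xs ≡ just y)
  immediately e = 1 , λ { zero t () _ ; (suc f) t _ _ → e }

  mutual
    eval-converges : ∀ {n} {p : Rec n} {xs y} → Eval O p xs y → Eventually (λ f t → eval f (os t) p xs ≡ just y)
    eval-converges ev-zer          = immediately refl
    eval-converges ev-succ         = immediately refl
    eval-converges ev-proj         = immediately refl
    eval-converges (ev-comp ds d)  =
      eventually-suc (λ (e₁ , e₂) → >>=-just⁺ e₁ e₂) (eventually-× (evalVec-converges ds) (eval-converges d))
    eval-converges (ev-prec0 d)    = eventually-suc id (eval-converges d)
    eval-converges (ev-precS d e)  =
      eventually-suc (λ (e₁ , e₂) → >>=-just⁺ e₁ e₂) (eventually-× (eval-converges d) (eval-converges e))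
    eval-converges {xs = xs} {y} (ev-mu {f = g} d below) =
      eventually-suc (λ { (zero-at , below-at , y<f) → search-complete _ _ g xs zero-at below-at 0 _ z≤n y<f })
        (eventually-× (eval-converges d) (eventually-× below-converges (fuel-eventually-> y)))
      where
      below-converges : Eventually (λ f t → ∀ w → w < y → ∃ λ k → eval f (os t) g (w ∷ xs) ≡ just (suc k))
      below-converges = eventually-∀< y λ w w<y →
        eventually-map (proj₁ (below w w<y) ,_) (eval-converges (proj₂ (below w w<y)))
    eval-converges (ev-query o)    with os→O _ _ o
    ... | t₀ , conv = eventually-suc id (t₀ , λ f t _ t₀≤t → conv t t₀≤t)

    evalVec-converges : ∀ {n m} {xs : Vec ℕ n} {gs : Vec (Rec n) m} {ys} → EvalVec O xs gs ys →
                        Eventually (λ f t → evalVec f (os t) gs xs ≡ just ys)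
    evalVec-converges []       = 0 , λ _ _ _ _ → refl
    evalVec-converges (d ∷ ds) =
      eventually-map (λ (e₁ , e₂) → >>=-just⁺ e₁ (cong (Maybe.map _) e₂))
        (eventually-× (eval-converges d) (evalVec-converges ds))

-- An enumeration of all pairs of programs

basic : (n : ℕ) → List (Rec n)
basic 1 = succ List.∷ query List.∷ List.[]
basic _ = List.[]

projections : (n : ℕ) → List (Rec n)
projections n = List.map proj (allFin n)

mutual
  programs : ℕ → (n : ℕ) → List (Rec n)
  programs zero    n = List.[]
  programs (suc s) n = zer List.∷ basic n ++ projections n ++ compositions s n ++ recursions s n ++ minimisations s n

  compositions : ℕ → (n : ℕ) → List (Rec n)
  compositions s n = concatMap (compositionsOfArity s n) (upTo (suc s))

  compositionsOfArity : ℕ → (n m : ℕ) → List (Rec n)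
  compositionsOfArity s n m = cartesianProductWith comp (programs s m) (vectors s n m)

  recursions : ℕ → (n : ℕ) → List (Rec n)
  recursions s zero    = List.[]
  recursions s (suc n) = cartesianProductWith prec (programs s n) (programs s (suc (suc n)))

  minimisations : ℕ → (n : ℕ) → List (Rec n)
  minimisations s n = List.map mu (programs s (suc n))

  vectors : ℕ → (n m : ℕ) → List (Vec (Rec n) m)
  vectors s n zero    = [] List.∷ List.[]
  vectors s n (suc m) = cartesianProductWith _∷_ (programs s n) (vectors s n m)

mutual
  depth : ∀ {n} → Rec n → ℕ
  depth zer              = 1
  depth succ             = 1
  depth (proj i)         = 1
  depth (comp {m} f gs)  = suc (m ⊔ depth f ⊔ depthVec gs)
  depth (prec g h)       = suc (depth g ⊔ depth h)
  depth (mu f)           = suc (depth f)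
  depth query            = 1

  depthVec : ∀ {n m} → Vec (Rec n) m → ℕ
  depthVec []       = 0
  depthVec (g ∷ gs) = depth g ⊔ depthVec gs

mutual
  ∈-programs : ∀ {n s} (p : Rec n) → depth p ≤ s → p ∈ programs s n
  ∈-programs {s = suc s} zer      _ = here refl
  ∈-programs {s = suc s} succ     _ = there (here refl)
  ∈-programs {s = suc s} query    _ = there (there (here refl))
  ∈-programs {n} {suc s} (proj i) _ = there (∈-++⁺ʳ (basic n) (∈-++⁺ˡ (∈-map⁺ proj (∈-allFin i))))
  ∈-programs {n} {suc s} (comp {m} f gs) (s≤s d≤s) =
    there (∈-++⁺ʳ (basic n) (∈-++⁺ʳ (projections n) (∈-++⁺ˡ ∈-compositions)))
    where
    m≤s : m ≤ s
    m≤s = m⊔n≤o⇒m≤o m (depth f) (m⊔n≤o⇒m≤o (m ⊔ depth f) (depthVec gs) d≤s)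
    f≤s : depth f ≤ s
    f≤s = m⊔n≤o⇒n≤o m (depth f) (m⊔n≤o⇒m≤o (m ⊔ depth f) (depthVec gs) d≤s)
    gs≤s : depthVec gs ≤ s
    gs≤s = m⊔n≤o⇒n≤o (m ⊔ depth f) (depthVec gs) d≤s
    ∈-compositions : comp f gs ∈ compositions s n
    ∈-compositions = ∈-concatMap⁺ (compositionsOfArity s n)
      (lose (∈-upTo⁺ (s≤s m≤s)) (∈-cartesianProductWith⁺ comp (∈-programs f f≤s) (∈-vectors gs gs≤s)))
  ∈-programs {suc n} {suc s} (prec g h) (s≤s d≤s) =
    there (∈-++⁺ʳ (basic (suc n)) (∈-++⁺ʳ (projections (suc n)) (∈-++⁺ʳ (compositions s (suc n)) (∈-++⁺ˡ
      (∈-cartesianProductWith⁺ prec (∈-programs g (m⊔n≤o⇒m≤o _ _ d≤s)) (∈-programs h (m⊔n≤o⇒n≤o _ _ d≤s)))))))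
  ∈-programs {n} {suc s} (mu f) (s≤s d≤s) =
    there (∈-++⁺ʳ (basic n) (∈-++⁺ʳ (projections n) (∈-++⁺ʳ (compositions s n) (∈-++⁺ʳ (recursions s n)
      (∈-map⁺ mu (∈-programs f d≤s))))))

  ∈-vectors : ∀ {n m s} (gs : Vec (Rec n) m) → depthVec gs ≤ s → gs ∈ vectors s n m
  ∈-vectors []       _    = here refl
  ∈-vectors (g ∷ gs) d≤s  =
    ∈-cartesianProductWith⁺ _∷_ (∈-programs g (m⊔n≤o⇒m≤o _ _ d≤s)) (∈-vectors gs (m⊔n≤o⇒n≤o _ _ d≤s))

Requirement : Set
Requirement = Rec 2 × Rec 1

requirementsOfDepth : ℕ → List Requirement
requirementsOfDepth s = cartesianProduct (programs s 2) (programs s 1)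

∈-requirementsOfDepth : ∀ (R : Requirement) → ∃ λ s → R ∈ requirementsOfDepth s
∈-requirementsOfDepth (Θ , Φ) = depth Θ ⊔ depth Φ ,
  ∈-cartesianProduct⁺ (∈-programs Θ (m≤m⊔n _ _)) (∈-programs Φ (m≤n⊔m _ _))

∈⇒head-drop : ∀ {A : Set} {x : A} {xs} → x ∈ xs → ∃ λ j → head (drop j xs) ≡ just x
∈⇒head-drop (here refl) = 0 , refl
∈⇒head-drop (there x∈xs) with ∈⇒head-drop x∈xs
... | j , e = suc j , e

nextOnDiagonal : ℕ × ℕ → ℕ × ℕ
nextOnDiagonal (zero  , b) = suc b , 0
nextOnDiagonal (suc a , b) = a , suc b

-- walks through ℕ × ℕ along the anti-diagonals a + b = n, each from (n , 0) to (0 , n)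
unpair : ℕ → ℕ × ℕ
unpair zero    = 0 , 0
unpair (suc k) = nextOnDiagonal (unpair k)

unpair-surjective : ∀ a b → ∃ λ k → unpair k ≡ (a , b)
unpair-surjective a b = reach (a + b) a b refl
  where
  reach : ∀ n a b → a + b ≡ n → ∃ λ k → unpair k ≡ (a , b)
  reach n       a       (suc b) a+1+b≡n with reach n (suc a) b (trans (sym (+-suc a b)) a+1+b≡n)
  ... | k , e = suc k , cong nextOnDiagonal e
  reach zero    zero    zero    _       = 0 , refl
  reach (suc n) (suc a) zero    1+a+0≡n with reach n zero a (trans (sym (+-identityʳ a)) (suc-injective 1+a+0≡n))
  ... | k , e = suc k , cong nextOnDiagonal e

requirementAt : ℕ × ℕ → Requirement
requirementAt (s , j) = fromMaybe (zer , zer) (head (drop j (requirementsOfDepth s)))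

requirement : ℕ → Requirement
requirement = requirementAt ∘ unpair

requirement-surjective : ∀ R → ∃ λ r → requirement r ≡ R
requirement-surjective R with ∈-requirementsOfDepth R
... | s , R∈ with ∈⇒head-drop R∈
... | j , e with unpair-surjective s j
... | k , unpair-k = k , trans (cong requirementAt unpair-k) (cong (fromMaybe (zer , zer)) e)

isZero : ℕ → ℕ
isZero zero    = 1
isZero (suc _) = 0

parity : ℕ → ℕ
parity zero    = 0
parity (suc k) = isZero (parity k)

half : ℕ → ℕ
half zero    = 0
half (suc k) = half k + parity k

halveTimes : ℕ → ℕ → ℕ
halveTimes zero    u = u
halveTimes (suc i) u = half (halveTimes i u)

plusᴾ : Rec 2
plusᴾ = prec (proj (# 0)) (comp succ (proj (# 1) ∷ []))

isZeroᴾ : Rec 1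
isZeroᴾ = prec (comp succ (zer ∷ [])) zer

parityᴾ : Rec 1
parityᴾ = prec zer (comp isZeroᴾ (proj (# 1) ∷ []))

halfᴾ : Rec 1
halfᴾ = prec zer (comp plusᴾ (proj (# 1) ∷ comp parityᴾ (proj (# 0) ∷ []) ∷ []))

halveTimesᴾ : Rec 2
halveTimesᴾ = prec (proj (# 0)) (comp halfᴾ (proj (# 1) ∷ []))

bitᴾ : Rec 2
bitᴾ = comp parityᴾ (halveTimesᴾ ∷ [])

doubleᴾ : Rec 1
doubleᴾ = prec zer (comp succ (comp succ (proj (# 1) ∷ []) ∷ []))

-- on (z , u , n) it returns 0 exactly when z ∈ D u and 2n+1 ∈ D z
memberListingᴾ : Rec 3
memberListingᴾ = comp plusᴾ
  ( comp isZeroᴾ (comp bitᴾ (proj (# 0) ∷ proj (# 1) ∷ []) ∷ [])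
  ∷ comp isZeroᴾ (comp bitᴾ (comp succ (comp doubleᴾ (proj (# 2) ∷ []) ∷ []) ∷ proj (# 0) ∷ []) ∷ [])
  ∷ [])

Θᴳ : EnumOp
Θᴳ = mu memberListingᴾ

memberListing : ℕ → ℕ → ℕ → ℕ
memberListing z u n = isZero (bit u z) + isZero (bit z (suc (double n)))

isZero≤1 : ∀ b → isZero b ≤ 1
isZero≤1 zero    = ≤-refl
isZero≤1 (suc _) = z≤n

parity≤1 : ∀ k → parity k ≤ 1
parity≤1 zero    = z≤n
parity≤1 (suc k) = isZero≤1 (parity k)

isZero-involutive : ∀ {b} → b ≤ 1 → isZero (isZero b) ≡ b
isZero-involutive {zero}     _ = refl
isZero-involutive {suc zero} _ = refl
isZero-involutive {suc (suc _)} (s≤s ())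

isZero≡0⇒≡1 : ∀ {b} → b ≤ 1 → isZero b ≡ 0 → b ≡ 1
isZero≡0⇒≡1 {suc zero}    _          _ = refl
isZero≡0⇒≡1 {suc (suc _)} (s≤s ())

b+isZero[b]≡1 : ∀ {b} → b ≤ 1 → b + isZero b ≡ 1
b+isZero[b]≡1 {zero}     _ = refl
b+isZero[b]≡1 {suc zero} _ = refl
b+isZero[b]≡1 {suc (suc _)} (s≤s ())

parity≡%2 : ∀ k → parity k ≡ k % 2
parity≡%2 zero          = refl
parity≡%2 (suc zero)    = refl
parity≡%2 (suc (suc k)) = trans (isZero-involutive (parity≤1 k)) (parity≡%2 k)

half≡/2 : ∀ k → half k ≡ k / 2
half≡/2 zero          = refl
half≡/2 (suc zero)    = refl
half≡/2 (suc (suc k)) = begin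
  half k + parity k + isZero (parity k)    ≡⟨ +-assoc (half k) (parity k) _ ⟩
  half k + (parity k + isZero (parity k))  ≡⟨ cong (half k +_) (b+isZero[b]≡1 (parity≤1 k)) ⟩
  half k + 1                               ≡⟨ +-comm (half k) 1 ⟩
  suc (half k)                             ≡⟨ cong suc (half≡/2 k) ⟩
  suc (k / 2)                              ≡⟨ sym ([2+n]/2≡1+n/2 k) ⟩
  suc (suc k) / 2                          ∎
  where open ≡-Reasoning

halveTimes-half : ∀ i u → halveTimes i (half u) ≡ half (halveTimes i u)
halveTimes-half zero    u = refl
halveTimes-half (suc i) u = cong half (halveTimes-half i u)

parity∘halveTimes≡bit : ∀ i u → parity (halveTimes i u) ≡ bit u i
parity∘halveTimes≡bit zero    u = parity≡%2 u
parity∘halveTimes≡bit (suc i) u = begin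
  parity (half (halveTimes i u))  ≡⟨ cong parity (sym (halveTimes-half i u)) ⟩
  parity (halveTimes i (half u))  ≡⟨ parity∘halveTimes≡bit i (half u) ⟩
  bit (half u) i                  ≡⟨ cong (λ v → bit v i) (half≡/2 u) ⟩
  bit (u / 2) i                   ∎
  where open ≡-Reasoning

memberListing≡0⇔ : ∀ z u n → memberListing z u n ≡ 0 ⇔ (D u z × D z (suc (double n)))
memberListing≡0⇔ z u n = mk⇔
  (λ sum≡0 → isZero≡0⇒≡1 (bit≤1 u z) (m+n≡0⇒m≡0 (isZero (bit u z)) sum≡0) ,
             isZero≡0⇒≡1 (bit≤1 z (suc (double n))) (m+n≡0⇒n≡0 (isZero (bit u z)) sum≡0))
  (λ (z∈u , 2n+1∈z) → cong₂ (λ b b′ → isZero b + isZero b′) z∈u 2n+1∈z)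

module _ {O : Oracle} where

  plusᴾ-eval : ∀ k x → Eval O plusᴾ (k ∷ x ∷ []) (k + x)
  plusᴾ-eval zero    x = ev-prec0 ev-proj
  plusᴾ-eval (suc k) x = ev-precS (plusᴾ-eval k x) (ev-comp (ev-proj ∷ []) ev-succ)

  isZeroᴾ-eval : ∀ k → Eval O isZeroᴾ (k ∷ []) (isZero k)
  isZeroᴾ-eval zero    = ev-prec0 (ev-comp (ev-zer ∷ []) ev-succ)
  isZeroᴾ-eval (suc k) = ev-precS (isZeroᴾ-eval k) ev-zer

  parityᴾ-eval : ∀ k → Eval O parityᴾ (k ∷ []) (parity k)
  parityᴾ-eval zero    = ev-prec0 ev-zer
  parityᴾ-eval (suc k) = ev-precS (parityᴾ-eval k) (ev-comp (ev-proj ∷ []) (isZeroᴾ-eval (parity k)))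

  halfᴾ-eval : ∀ k → Eval O halfᴾ (k ∷ []) (half k)
  halfᴾ-eval zero    = ev-prec0 ev-zer
  halfᴾ-eval (suc k) = ev-precS (halfᴾ-eval k)
    (ev-comp (ev-proj ∷ ev-comp (ev-proj ∷ []) (parityᴾ-eval k) ∷ []) (plusᴾ-eval (half k) (parity k)))

  halveTimesᴾ-eval : ∀ i u → Eval O halveTimesᴾ (i ∷ u ∷ []) (halveTimes i u)
  halveTimesᴾ-eval zero    u = ev-prec0 ev-proj
  halveTimesᴾ-eval (suc i) u = ev-precS (halveTimesᴾ-eval i u) (ev-comp (ev-proj ∷ []) (halfᴾ-eval (halveTimes i u)))

  bitᴾ-eval : ∀ i u → Eval O bitᴾ (i ∷ u ∷ []) (bit u i)
  bitᴾ-eval i u = subst (Eval O bitᴾ (i ∷ u ∷ [])) (parity∘halveTimes≡bit i u)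
    (ev-comp (halveTimesᴾ-eval i u ∷ []) (parityᴾ-eval (halveTimes i u)))

  doubleᴾ-eval : ∀ n → Eval O doubleᴾ (n ∷ []) (double n)
  doubleᴾ-eval zero    = ev-prec0 ev-zer
  doubleᴾ-eval (suc n) = ev-precS (doubleᴾ-eval n) (ev-comp (ev-comp (ev-proj ∷ []) ev-succ ∷ []) ev-succ)

  memberListingᴾ-eval : ∀ z u n → Eval O memberListingᴾ (z ∷ u ∷ n ∷ []) (memberListing z u n)
  memberListingᴾ-eval z u n = ev-comp
    ( ev-comp (ev-comp (ev-proj ∷ ev-proj ∷ []) (bitᴾ-eval z u) ∷ []) (isZeroᴾ-eval _)
    ∷ ev-comp (ev-comp (ev-comp (ev-comp (ev-proj ∷ []) (doubleᴾ-eval n) ∷ []) ev-succ ∷ ev-proj ∷ [])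
                       (bitᴾ-eval _ z) ∷ [])
              (isZeroᴾ-eval _)
    ∷ [])
    (plusᴾ-eval _ _)

least-witness : ∀ {P : ℕ → Set} → Decidable P → ∀ n → P n → ∃ λ m → P m × (∀ k → k < m → ¬ P k)
least-witness {P} P? n pn with least-below (suc n)
  where
  least-below : ∀ n → (∃ λ m → P m × (∀ k → k < m → ¬ P k)) ⊎ (∀ k → k < n → ¬ P k)
  least-below zero    = inj₂ λ _ ()
  least-below (suc n) with least-below n | P? n
  ... | inj₁ least | _      = inj₁ least
  ... | inj₂ none  | yes pn = inj₁ (n , pn , none)
  ... | inj₂ none  | no ¬pn =
    inj₂ λ k k<1+n → [ none k , (λ { refl → ¬pn }) ]′ (m≤n⇒m<n∨m≡n (≤-pred k<1+n))
... | inj₁ least = least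
... | inj₂ none  = ⊥-elim (none n (n<1+n n) pn)

≢0⇒suc : ∀ {m} → ¬ m ≡ 0 → ∃ λ k → m ≡ suc k
≢0⇒suc {zero}  m≢0 = ⊥-elim (m≢0 refl)
≢0⇒suc {suc k} _   = k , refl

Θᴳ-spec : ∀ u n → Θᴳ ∋⟨ u , n ⟩ ⇔ ∃ λ z → D u z × D z (suc (double n))
Θᴳ-spec u n = mk⇔ sound complete
  where
  sound : Θᴳ ∋⟨ u , n ⟩ → ∃ λ z → D u z × D z (suc (double n))
  sound (z , ev-mu zero-at _) =
    z , to (memberListing≡0⇔ z u n) (Eval-functional emptyOracle-functional (memberListingᴾ-eval z u n) zero-at)

  complete : (∃ λ z → D u z × D z (suc (double n))) → Θᴳ ∋⟨ u , n ⟩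
  complete (z , listed)
    with least-witness (λ w → memberListing w u n ≟ 0) z (from (memberListing≡0⇔ z u n) listed)
  ... | y , zero-at , nonzero-below =
    y , ev-mu (eval-at y zero-at) λ w w<y → let k , eq = ≢0⇒suc (nonzero-below w w<y) in k , eval-at w eq
    where
    eval-at : ∀ w {k} → memberListing w u n ≡ k → Eval emptyOracle memberListingᴾ (w ∷ u ∷ n ∷ []) k
    eval-at w eq = subst (Eval emptyOracle memberListingᴾ _) eq (memberListingᴾ-eval w u n)

interleave : (ℕ → Bool) → (ℕ → Bool) → ℕ → Bool
interleave E O zero    = E 0
interleave E O (suc j) = interleave O (E ∘ suc) j

interleave-double : ∀ E O y → interleave E O (double y) ≡ E y
interleave-double E O zero    = refl
interleave-double E O (suc y) = interleave-double (E ∘ suc) (O ∘ suc) y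

interleave-suc-double : ∀ E O y → interleave E O (suc (double y)) ≡ O y
interleave-suc-double E O zero    = refl
interleave-suc-double E O (suc y) = interleave-suc-double (E ∘ suc) (O ∘ suc) y

double-or-suc-double : ∀ j → ∃ λ y → j ≡ double y ⊎ j ≡ suc (double y)
double-or-suc-double zero          = 0 , inj₁ refl
double-or-suc-double (suc zero)    = 0 , inj₂ refl
double-or-suc-double (suc (suc j)) with double-or-suc-double j
... | y , inj₁ refl = suc y , inj₁ refl
... | y , inj₂ refl = suc y , inj₂ refl

double-≤⁻ : ∀ {a y} → double a ≤ suc (double y) → a ≤ y
double-≤⁻ {zero}              _                   = z≤n
double-≤⁻ {suc a} {zero}      (s≤s ())
double-≤⁻ {suc a} {suc y}     (s≤s (s≤s 2a≤1+2y)) = s≤s (double-≤⁻ 2a≤1+2y)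

n≤double : ∀ n → n ≤ double n
n≤double zero    = z≤n
n≤double (suc n) = s≤s (m≤n⇒m≤1+n (n≤double n))

-- odd digits 2y+1 hold the members y of S, even digits 2y hold the singleton {tag}
code : (ℕ → Bool) → ℕ → ℕ → ℕ
code S B tag = fromBits (double (B + suc tag)) (interleave (_≡ᵇ tag) S)

module _ {S : ℕ → Bool} {B : ℕ} (S<B : ∀ y → B ≤ y → ¬ T (S y)) (tag : ℕ) where

  code-digits-vanish : ∀ j → double (B + suc tag) ≤ j → ¬ T (interleave (_≡ᵇ tag) S j)
  code-digits-vanish j big with double-or-suc-double j
  ... | y , inj₁ refl =
    λ y≡tag → <⇒≢ tag<y (sym (≡ᵇ⇒≡ y tag (subst T (interleave-double (_≡ᵇ tag) S y) y≡tag)))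
    where
    tag<y : tag < y
    tag<y = <-≤-trans (s≤s (m≤n+m tag B)) (subst (_≤ y) (+-suc B tag) (double-≤⁻ (m≤n⇒m≤1+n big)))
  ... | y , inj₂ refl =
    S<B y (≤-trans (m≤m+n B (suc tag)) (double-≤⁻ big)) ∘ subst T (interleave-suc-double (_≡ᵇ tag) S y)

  D-code-odd : ∀ y → D (code S B tag) (suc (double y)) ⇔ T (S y)
  D-code-odd y = subst (λ b → D (code S B tag) (suc (double y)) ⇔ T b)
    (interleave-suc-double (_≡ᵇ tag) S y) (D-fromBits _ _ code-digits-vanish (suc (double y)))

  D-code-even : ∀ y → D (code S B tag) (double y) ⇔ y ≡ tag
  D-code-even y = ⇔.trans
    (subst (λ b → D (code S B tag) (double y) ⇔ T b)
      (interleave-double (_≡ᵇ tag) S y) (D-fromBits _ _ code-digits-vanish (double y)))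
    (mk⇔ (≡ᵇ⇒≡ y tag) (≡⇒≡ᵇ y tag))

-- The construction

emptyᴾᴼ : PartialOracle
emptyᴾᴼ _ = just 0

subsetᵇ : ℕ → (ℕ → Bool) → Bool
subsetᵇ u S = allBelow u λ i → not (bit u i ≡ᵇ 1) ∨ S i

subsetᵇ⁺ : ∀ {u S} → (∀ i → D u i → T (S i)) → T (subsetᵇ u S)
subsetᵇ⁺ {u} {S} Du⊆S = allBelow⁺ u _ λ i _ → member-or-absent i
  where
  member-or-absent : ∀ i → T (not (bit u i ≡ᵇ 1) ∨ S i)
  member-or-absent i with bit u i ≡ᵇ 1 in eq
  ... | true  = Du⊆S i (≡ᵇ⇒≡ (bit u i) 1 (subst T (sym eq) _))
  ... | false = _

subsetᵇ⁻ : ∀ {u S} → T (subsetᵇ u S) → ∀ i → D u i → T (S i)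
subsetᵇ⁻ {u} {S} sub i i∈u = subst (λ b → T (not (b ≡ᵇ 1) ∨ S i)) i∈u (allBelow⁻ u _ sub i (D⇒< i i∈u))

-- x ∈ Θ (S), as seen from some D u ⊆ S with u ≤ t through a computation of at most t steps
enumeratedBy : ℕ → EnumOp → (ℕ → Bool) → ℕ → Bool
enumeratedBy t Θ S x = anyBelow (suc t) λ u → subsetᵇ u S ∧ is-just (eval t emptyᴾᴼ Θ (u ∷ x ∷ []))

restrict : ℕ → (ℕ → Bool) → PartialOracle
restrict t E x = if x ≤ᵇ t then just (if E x then 1 else 0) else nothing

returnsZero : Maybe ℕ → Bool
returnsZero (just zero) = true
returnsZero _           = false

returnsZero⇔ : ∀ {m} → T (returnsZero m) ⇔ m ≡ just 0
returnsZero⇔ {just zero}    = mk⇔ (λ _ → refl) (λ _ → _)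
returnsZero⇔ {just (suc _)} = mk⇔ (λ ()) (λ ())
returnsZero⇔ {nothing}      = mk⇔ (λ ()) (λ ())

-- Φ, given the stage-t approximation to Θ (S), claims within t steps that p is not in G
succeeds : ℕ → (ℕ → Bool) → Requirement → ℕ → Bool
succeeds t S (Θ , Φ) p = returnsZero (eval t (restrict t (enumeratedBy t Θ S)) Φ (p ∷ []))

record Stage : Set where
  field
    members   : ℕ → Bool
    bound     : ℕ
    witnesses : ℕ → ℕ
open Stage

stageCode : Stage → ℕ → ℕ
stageCode σ = code (members σ) (bound σ)

-- requirement t receives its witness at stage t, and keeps it
nextWitnesses : ℕ → Stage → ℕ → ℕ
nextWitnesses t σ r = if r ≡ᵇ t then stageCode σ (suc t) else witnesses σ r

newMember : ℕ → Stage → ℕ → Bool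
newMember t σ x = (x ≡ᵇ stageCode σ 0) ∨ anyBelow (suc t) λ r →
  (x ≡ᵇ nextWitnesses t σ r) ∧ succeeds t (members σ) (requirement r) (nextWitnesses t σ r)

next : ℕ → Stage → Stage
next t σ = record
  { members   = λ x → members σ x ∨ newMember t σ x
  ; bound     = suc (bound σ ⊔ stageCode σ 0 ⊔ maxBelow (suc t) (nextWitnesses t σ))
  ; witnesses = nextWitnesses t σ
  }

stage : ℕ → Stage
stage zero    = record { members = λ _ → false ; bound = 0 ; witnesses = λ _ → 0 }
stage (suc t) = next t (stage t)

G[_] : ℕ → ℕ → Bool
G[ t ] = members (stage t)

B[_] : ℕ → ℕ
B[ t ] = bound (stage t)

marker : ℕ → ℕ
marker r = stageCode (stage r) 0

witness : ℕ → ℕ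
witness r = stageCode (stage r) (suc r)

G : Pred
G x = ∃ λ t → T (G[ t ] x)

witnesses-stable : ∀ t r → r < t → witnesses (stage t) r ≡ witness r
witnesses-stable (suc t) r r<1+t with r ≡ᵇ t in eq
... | true  = cong witness (sym (≡ᵇ⇒≡ r t (subst T (sym eq) _)))
... | false with m≤n⇒m<n∨m≡n (≤-pred r<1+t)
...   | inj₁ r<t  = witnesses-stable t r r<t
...   | inj₂ refl = ⊥-elim (subst T eq (≡⇒≡ᵇ r r refl))

data AddedAt (t : ℕ) : ℕ → Set where
  marker-added  : AddedAt t (marker t)
  witness-added : ∀ {r} → r ≤ t → T (succeeds t G[ t ] (requirement r) (witness r)) → AddedAt t (witness r)

G[suc]⁻ : ∀ t x → T (G[ suc t ] x) → T (G[ t ] x) ⊎ AddedAt t x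
G[suc]⁻ t x x∈ with to T-∨ x∈
... | inj₁ old = inj₁ old
... | inj₂ new with to T-∨ new
...   | inj₁ x≡marker = inj₂ (subst (AddedAt t) (sym (≡ᵇ⇒≡ x (marker t) x≡marker)) marker-added)
...   | inj₂ some with anyBelow⁻ (suc t) _ some
...     | r , r<1+t , hit = inj₂ (witness-candidate-added r (≤-pred r<1+t) (to T-∧ hit))
  where
  witness-candidate-added : ∀ r → r ≤ t →
    T (x ≡ᵇ witnesses (stage (suc t)) r) × T (succeeds t G[ t ] (requirement r) (witnesses (stage (suc t)) r)) →
    AddedAt t x
  witness-candidate-added r r≤t hit with witnesses (stage (suc t)) r | witnesses-stable (suc t) r (s≤s r≤t)
  ... | _ | refl = subst (AddedAt t) (sym (≡ᵇ⇒≡ x (witness r) (proj₁ hit))) (witness-added r≤t (proj₂ hit))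

AddedAt⇒G[suc] : ∀ {t x} → AddedAt t x → T (G[ suc t ] x)
AddedAt⇒G[suc] {t} marker-added = from (T-∨ {G[ t ] (marker t)})
  (inj₂ (from (T-∨ {marker t ≡ᵇ marker t}) (inj₁ (≡⇒≡ᵇ (marker t) (marker t) refl))))
AddedAt⇒G[suc] {t} (witness-added {r} r≤t success) =
  from (T-∨ {G[ t ] (witness r)}) (inj₂ (from (T-∨ {witness r ≡ᵇ marker t})
    (inj₂ (anyBelow⁺ (suc t) _ (s≤s r≤t) (from T-∧ (x≡w , success′))))))
  where
  w≡witness : witnesses (stage (suc t)) r ≡ witness r
  w≡witness = witnesses-stable (suc t) r (s≤s r≤t)
  x≡w : T (witness r ≡ᵇ witnesses (stage (suc t)) r)
  x≡w = ≡⇒≡ᵇ _ _ (sym w≡witness)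
  success′ : T (succeeds t G[ t ] (requirement r) (witnesses (stage (suc t)) r))
  success′ = subst (λ p → T (succeeds t G[ t ] (requirement r) p)) (sym w≡witness) success

G⇒AddedAt : ∀ {x} → G x → ∃ λ t → AddedAt t x
G⇒AddedAt {x} (t , x∈) = added-by t x∈
  where
  added-by : ∀ t → T (G[ t ] x) → ∃ λ t′ → AddedAt t′ x
  added-by (suc t) x∈ with G[suc]⁻ t x x∈
  ... | inj₁ old   = added-by t old
  ... | inj₂ added = t , added

AddedAt⇒G : ∀ {t x} → AddedAt t x → G x
AddedAt⇒G {t} added = suc t , AddedAt⇒G[suc] added

G[]-mono : ∀ {s t x} → s ≤ t → T (G[ s ] x) → T (G[ t ] x)
G[]-mono s≤t = mono (≤⇒≤′ s≤t)
  where
  mono : ∀ {s t x} → s ≤′ t → T (G[ s ] x) → T (G[ t ] x)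
  mono ≤′-refl         x∈ = x∈
  mono {x = x} (≤′-step {t} s≤′t) x∈ = from (T-∨ {G[ t ] x}) (inj₁ (mono s≤′t x∈))

B[]-mono : ∀ {s t} → s ≤ t → B[ s ] ≤ B[ t ]
B[]-mono s≤t = mono (≤⇒≤′ s≤t)
  where
  mono : ∀ {s t} → s ≤′ t → B[ s ] ≤ B[ t ]
  mono ≤′-refl         = ≤-refl
  mono (≤′-step s≤′t) = m≤n⇒m≤1+n (m≤n⇒m≤n⊔o _ (m≤n⇒m≤n⊔o _ (mono s≤′t)))

marker<B[suc] : ∀ r → marker r < B[ suc r ]
marker<B[suc] r = s≤s (m≤n⇒m≤n⊔o _ (m≤n⊔m B[ r ] (marker r)))

witness<B[suc] : ∀ r → witness r < B[ suc r ]
witness<B[suc] r = s≤s (m≤n⇒m≤o⊔n (B[ r ] ⊔ marker r)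
  (subst (_≤ maxBelow (suc r) w) (witnesses-stable (suc r) r ≤-refl) (maxBelow-upper (suc r) w ≤-refl)))
  where
  w : ℕ → ℕ
  w = nextWitnesses r (stage r)

G[]-bounded : ∀ t y → T (G[ t ] y) → y < B[ t ]
G[]-bounded (suc t) y y∈ with G[suc]⁻ t y y∈
... | inj₁ old                        = <-≤-trans (G[]-bounded t y old) (B[]-mono (n≤1+n t))
... | inj₂ marker-added               = marker<B[suc] t
... | inj₂ (witness-added {r} r≤t _) = <-≤-trans (witness<B[suc] r) (B[]-mono (s≤s r≤t))

G[]-beyond-bound : ∀ t y → B[ t ] ≤ y → ¬ T (G[ t ] y)
G[]-beyond-bound t y B≤y y∈ = <⇒≱ (G[]-bounded t y y∈) B≤y

stageCode-lists : ∀ r tag n → D (stageCode (stage r) tag) (suc (double n)) ⇔ T (G[ r ] n)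
stageCode-lists r = D-code-odd (G[]-beyond-bound r)

stageCode-tag : ∀ r tag y → D (stageCode (stage r) tag) (double y) ⇔ y ≡ tag
stageCode-tag r = D-code-even (G[]-beyond-bound r)

stageCode-injectiveʳ : ∀ {r r′ tag tag′} → stageCode (stage r) tag ≡ stageCode (stage r′) tag′ → tag ≡ tag′
stageCode-injectiveʳ {r} {r′} {tag} {tag′} eq =
  to (stageCode-tag r′ tag′ tag) (subst (λ c → D c (double tag)) eq (from (stageCode-tag r tag tag) refl))

marker≢witness : ∀ t r → marker t ≢ witness r
marker≢witness t r eq = 0≢1+n (stageCode-injectiveʳ {t} {r} eq)

witness-injective : ∀ {r r′} → witness r ≡ witness r′ → r ≡ r′
witness-injective {r} {r′} eq = suc-injective (stageCode-injectiveʳ {r} {r′} eq)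

witness-added⁻ : ∀ {t} r → AddedAt t (witness r) → r ≤ t × T (succeeds t G[ t ] (requirement r) (witness r))
witness-added⁻ r added = go added refl
  where
  go : ∀ {t r x} → AddedAt t x → x ≡ witness r → r ≤ t × T (succeeds t G[ t ] (requirement r) (witness r))
  go {t} {r} marker-added                     eq = ⊥-elim (marker≢witness t r eq)
  go {r = r} (witness-added {r′} r′≤t success) eq with witness-injective {r′} {r} eq
  ... | refl = r′≤t , success

data CodeOfStage (r : ℕ) : ℕ → Set where
  marker-code  : CodeOfStage r (marker r)
  witness-code : CodeOfStage r (witness r)

AddedAt⇒CodeOfStage : ∀ {t x} → AddedAt t x → ∃ λ r → CodeOfStage r x
AddedAt⇒CodeOfStage {t} marker-added           = t , marker-code
AddedAt⇒CodeOfStage (witness-added {r} _ _) = r , witness-code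

CodeOfStage-lists : ∀ {r x} → CodeOfStage r x → ∀ n → D x (suc (double n)) ⇔ T (G[ r ] n)
CodeOfStage-lists {r} marker-code  = stageCode-lists r 0
CodeOfStage-lists {r} witness-code = stageCode-lists r (suc r)

CodeOfStage-late : ∀ {r s x} → CodeOfStage r x → B[ s ] ≤ x → s ≤ r
CodeOfStage-late {r} {s} {x} x-codes B[s]≤x with <-≤-connex r s
... | inj₂ s≤r = s≤r
... | inj₁ r<s = ⊥-elim (<⇒≱ (x<B[1+r] x-codes) (≤-trans (B[]-mono r<s) B[s]≤x))
  where
  x<B[1+r] : ∀ {x} → CodeOfStage r x → x < B[ suc r ]
  x<B[1+r] marker-code  = marker<B[suc] r
  x<B[1+r] witness-code = witness<B[suc] r

G-lists-members-of-G : ∀ {x n} → G x → D x (suc (double n)) → G n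
G-lists-members-of-G {n = n} x∈G n∈x with G⇒AddedAt x∈G
... | _ , added with AddedAt⇒CodeOfStage added
... | r , x-codes = r , to (CodeOfStage-lists x-codes n) n∈x

marker-increasing : ∀ r → marker r < marker (suc r)
marker-increasing r = begin-strict
  marker r                   ≤⟨ n≤double (marker r) ⟩
  double (marker r)          <⟨ n<1+n _ ⟩
  suc (double (marker r))    <⟨ D⇒< _ marker-listed ⟩
  marker (suc r)             ∎
  where
  open ≤-Reasoning
  marker-listed : D (marker (suc r)) (suc (double (marker r)))
  marker-listed = from (stageCode-lists (suc r) 0 (marker r)) (AddedAt⇒G[suc] {r} marker-added)

G-infinite : Infinite G
G-infinite n = marker n , n≤marker n , AddedAt⇒G (marker-added {n})
  where
  n≤marker : ∀ n → n ≤ marker n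
  n≤marker zero    = z≤n
  n≤marker (suc n) = <-≤-trans (s≤s (n≤marker n)) (marker-increasing n)

G-introenumerable : ∀ C → Infinite C → C ⊆ G → Θᴳ ⟨ C ⟩ ≐ G
G-introenumerable C C-infinite C⊆G n = sound , complete
  where
  sound : (Θᴳ ⟨ C ⟩) n → G n
  sound (u , Du⊆C , listed) with to (Θᴳ-spec u n) listed
  ... | z , z∈u , n∈z = G-lists-members-of-G (C⊆G z (Du⊆C z z∈u)) n∈z

  complete : G n → (Θᴳ ⟨ C ⟩) n
  complete (s , n∈G[s]) with C-infinite B[ s ]
  ... | x , B[s]≤x , x∈C with G⇒AddedAt (C⊆G x x∈C)
  ... | _ , added with AddedAt⇒CodeOfStage added
  ... | r , x-codes =
    singleton x , x⊆C , from (Θᴳ-spec (singleton x) n) (x , from (D-singleton x x) refl , n∈x)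
    where
    x⊆C : D (singleton x) ⊆ C
    x⊆C j j∈ = subst C (sym (to (D-singleton x j) j∈)) x∈C
    n∈x : D x (suc (double n))
    n∈x = from (CodeOfStage-lists x-codes n) (G[]-mono {s} (CodeOfStage-late {s = s} x-codes B[s]≤x) n∈G[s])

-- the finite oracle restrict t E, extended by X beyond t
patch : ℕ → (ℕ → Bool) → Pred → Pred
patch t E X x = (x ≤ t × T (E x)) ⊎ (t < x × X x)

restrict-⊆-patch : ∀ t E X → graph (restrict t E) ⊆ᴼ χ (patch t E X)
restrict-⊆-patch t E X x b answer with x ≤ᵇ t in x≤ᵇt | E x in Ex
restrict-⊆-patch t E X x _ refl | true | true  = inj₁ (≤ᵇ⇒≤ x t (subst T (sym x≤ᵇt) _) , subst T (sym Ex) _)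
restrict-⊆-patch t E X x _ refl | true | false = λ
  { (inj₁ (_ , x∈E))  → subst T Ex x∈E
  ; (inj₂ (t<x , _)) → <⇒≱ t<x (≤ᵇ⇒≤ x t (subst T (sym x≤ᵇt) _)) }

patch-infinite : ∀ t E X → Infinite X → Infinite (patch t E X)
patch-infinite t E X X-infinite n with X-infinite (n ⊔ suc t)
... | m , n⊔1+t≤m , m∈X =
  m , m⊔n≤o⇒m≤o n (suc t) n⊔1+t≤m , inj₂ (m⊔n≤o⇒n≤o n (suc t) n⊔1+t≤m , m∈X)

patch-⊆ : ∀ t E X → (∀ x → T (E x) → X x) → patch t E X ⊆ X
patch-⊆ t E X E⊆X x (inj₁ (_ , x∈E)) = E⊆X x x∈E
patch-⊆ t E X E⊆X x (inj₂ (_ , x∈X)) = x∈X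

restrict-≤ : ∀ {t x} E → x ≤ t → restrict t E x ≡ just (if E x then 1 else 0)
restrict-≤ {t} {x} E x≤t with x ≤ᵇ t in x≤ᵇt
... | true  = refl
... | false = ⊥-elim (subst T x≤ᵇt (≤⇒≤ᵇ x≤t))

restrict-converges : ∀ (E : ℕ → ℕ → Bool) X → (∀ t x → T (E t x) → X x) →
                     (∀ x → X x → ∃ λ t₀ → ∀ t → t₀ ≤ t → T (E t x)) →
                     ConvergesTo (λ t → restrict t (E t)) (χ X)
restrict-converges E X sound complete x zero x∉X = x , λ t x≤t →
  trans (restrict-≤ (E t) x≤t) (cong (λ b → just (if b then 1 else 0)) (¬T⇒false (x∉X ∘ sound t x)))
  where
  ¬T⇒false : ∀ {b} → ¬ T b → b ≡ false
  ¬T⇒false {false} _  = refl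
  ¬T⇒false {true}  ¬T = ⊥-elim (¬T _)
restrict-converges E X sound complete x (suc zero) x∈X with complete x x∈X
... | t₀ , eventually = x ⊔ t₀ , λ t x⊔t₀≤t →
  trans (restrict-≤ (E t) (m⊔n≤o⇒m≤o x t₀ x⊔t₀≤t))
        (cong (λ b → just (if b then 1 else 0)) (T⇒true (eventually t (m⊔n≤o⇒n≤o x t₀ x⊔t₀≤t))))
  where
  T⇒true : ∀ {b} → T b → b ≡ true
  T⇒true {true} _ = refl
restrict-converges E X sound complete x (suc (suc _)) ()

is-just⇒≡just : ∀ {A : Set} (m : Maybe A) → T (is-just m) → ∃ λ a → m ≡ just a
is-just⇒≡just (just a) _ = a , refl

emptyᴾᴼ-converges : ConvergesTo (λ _ → emptyᴾᴼ) emptyOracle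
emptyᴾᴼ-converges _ _ refl = 0 , λ _ _ → refl

enumeratedBy-sound : ∀ Θ t x → T (enumeratedBy t Θ G[ t ] x) → (Θ ⟨ G ⟩) x
enumeratedBy-sound Θ t x visible with anyBelow⁻ (suc t) _ visible
... | u , _ , u-ok with to (T-∧ {subsetᵇ u G[ t ]}) u-ok
... | Du⊆G[t] , halts with is-just⇒≡just (eval t emptyᴾᴼ Θ (u ∷ x ∷ [])) halts
... | y , e = u , (λ i i∈u → t , subsetᵇ⁻ Du⊆G[t] i i∈u) , y ,
  Eval-mono (λ _ _ → sym ∘ just-injective) (eval-sound t emptyᴾᴼ Θ _ e)

finite-⊆-stage : ∀ u → D u ⊆ G → ∃ λ s → ∀ i → D u i → T (G[ s ] i)
finite-⊆-stage u Du⊆G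
  with common-bound (λ i s → D u i → T (G[ s ] i)) (λ s≤s′ i∈ d → G[]-mono s≤s′ (i∈ d)) u in-some-stage
  where
  in-some-stage : ∀ i → i < u → ∃ λ s → D u i → T (G[ s ] i)
  in-some-stage i _ with bit u i ≟ 1
  ... | yes i∈u = proj₁ (Du⊆G i i∈u) , λ _ → proj₂ (Du⊆G i i∈u)
  ... | no  i∉u = 0 , ⊥-elim ∘ i∉u
... | s , Du⊆G[s] = s , λ i i∈u → Du⊆G[s] i (D⇒< i i∈u) i∈u

enumeratedBy-complete : ∀ Θ x → (Θ ⟨ G ⟩) x →
                        ∃ λ t₀ → ∀ t → t₀ ≤ t → T (enumeratedBy t Θ G[ t ] x)
enumeratedBy-complete Θ x (u , Du⊆G , y , ev) with finite-⊆-stage u Du⊆G | eval-converges emptyᴾᴼ-converges ev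
... | s , Du⊆G[s] | t₁ , halts = u ⊔ s ⊔ t₁ , λ t u⊔s⊔t₁≤t →
  let u⊔s≤t = m⊔n≤o⇒m≤o (u ⊔ s) t₁ u⊔s⊔t₁≤t
      t₁≤t  = m⊔n≤o⇒n≤o (u ⊔ s) t₁ u⊔s⊔t₁≤t
  in anyBelow⁺ (suc t) _ (s≤s (m⊔n≤o⇒m≤o u s u⊔s≤t)) (from (T-∧ {subsetᵇ u G[ t ]})
       ( subsetᵇ⁺ (λ i i∈u → G[]-mono (m⊔n≤o⇒n≤o u s u⊔s≤t) (Du⊆G[s] i i∈u))
       , subst (T ∘ is-just) (sym (halts t t t₁≤t t₁≤t)) _ ))

approximation : EnumOp → ℕ → PartialOracle
approximation Θ t = restrict t (enumeratedBy t Θ G[ t ])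

approximation-converges : ∀ Θ → ConvergesTo (approximation Θ) (χ (Θ ⟨ G ⟩))
approximation-converges Θ =
  restrict-converges (λ t → enumeratedBy t Θ G[ t ]) (Θ ⟨ G ⟩) (enumeratedBy-sound Θ) (enumeratedBy-complete Θ)

-- The diagonalisation

module Diagonalisation (A : Pred) (A-infinite : Infinite A) (Θ : EnumOp) (Θ⟨G⟩≐A : Θ ⟨ G ⟩ ≐ A)
         (Φ : TuringFunctional) (Φ-uniform : ∀ C → Infinite C → C ⊆ A → Φ ^ C ≡χ G)
         (r : ℕ) (r↦ΘΦ : requirement r ≡ (Θ , Φ)) where

  succeeds-at⇔ : ∀ t → T (succeeds t G[ t ] (requirement r) (witness r)) ⇔
                        eval t (approximation Θ t) Φ (witness r ∷ []) ≡ just 0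
  succeeds-at⇔ t rewrite r↦ΘΦ = returnsZero⇔

  -- if it had entered, Φ would err on an infinite subset of A agreeing with the finite oracle it consulted
  witness∉G : ¬ G (witness r)
  witness∉G w∈G with G⇒AddedAt w∈G
  ... | t , added with witness-added⁻ r added
  ... | _ , success =
    1+n≢0 (Eval-functional (χ-functional C) (proj₁ (Φ-uniform C C-infinite C⊆A (witness r)) w∈G) Φ-says-0)
    where
    E : ℕ → Bool
    E = enumeratedBy t Θ G[ t ]
    C : Pred
    C = patch t E A
    C-infinite : Infinite C
    C-infinite = patch-infinite t E A A-infinite
    C⊆A : C ⊆ A
    C⊆A = patch-⊆ t E A λ x x∈E → proj₁ (Θ⟨G⟩≐A x) (enumeratedBy-sound Θ t x x∈E)
    Φ-says-0 : Eval (χ C) Φ (witness r ∷ []) 0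
    Φ-says-0 = Eval-mono (restrict-⊆-patch t E A)
      (eval-sound t (approximation Θ t) Φ (witness r ∷ []) (to (succeeds-at⇔ t) success))

  witness∈G : G (witness r)
  witness∈G with eval-converges (approximation-converges Θ) Φ-says-0
    where
    Φ-says-0 : Eval (χ (Θ ⟨ G ⟩)) Φ (witness r ∷ []) 0
    Φ-says-0 = Eval-mono (χ-cong (swap ∘ Θ⟨G⟩≐A))
      (proj₂ (Φ-uniform A A-infinite (λ _ a → a) (witness r)) witness∉G)
  ... | t₀ , converged =
    AddedAt⇒G (witness-added (m≤n⊔m t₀ r) (from (succeeds-at⇔ t) (converged t t t₀≤t t₀≤t)))
    where
    t : ℕ
    t = t₀ ⊔ r
    t₀≤t : t₀ ≤ t
    t₀≤t = m≤m⊔n t₀ r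

proposition4p18 : Σ Pred λ G → UniformlyIntroenumerable G
                    × (∀ A → Infinite A → A ≤e G → ¬ (G ≤uiT A))
proposition4p18 = G , (G-infinite , Θᴳ , G-introenumerable) , no-uniform-reduction
  where
  no-uniform-reduction : ∀ A → Infinite A → A ≤e G → ¬ (G ≤uiT A)
  no-uniform-reduction A A-infinite (Θ , Θ⟨G⟩≐A) (Φ , Φ-uniform) with requirement-surjective (Θ , Φ)
  ... | r , r↦ΘΦ = witness∉G witness∈G
    where open Diagonalisation A A-infinite Θ Θ⟨G⟩≐A Φ Φ-uniform r r↦ΘΦ
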